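{- For sufficiently large $n$ the following holds. Let $V$ be a set of $n$ vertices. There is a set of $t = 4\lceil \log n\rceil$ bipartite graphs $F_1,\ldots,F_t$ on $V$ (each $F_i$ having a fixed bipartition $V = A_i \sqcup B_i$, all its edges going between $A_i$ and $B_i$), and an online algorithm $\mathcal{A}$ which processes a stream of edges of a graph $G$ on $V$ and assigns each arriving edge to one of the $t$ graphs $F_1,\dots,F_t$, such that at each time, for each vertex $v$ and each $i\in[t]$, $\deg_{F_i}(v) \le \frac{300}{\log n}\deg_G(v) + 1$, where degrees are taken in the graphs formed by the edges that have arrived so far. The algorithm uses $O(n(\log n)(\log \Delta))$ bits of space, where $\Delta$ is the maximum degree of $G$.
   Context: Logarithms are base 2. An online assignment algorithm must irrevocably decide, at the time an edge arrives, which $F_i$ receives it. Space is measured in bits of working memory. -}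

module Defs where

open import Data.Nat using (ℕ; zero; suc; _+_; _*_; _∸_; _^_; _≤_; _⊔_)
open import Data.Nat.Logarithm using (⌈log₂_⌉)
open import Data.Bool using (Bool; true; false; if_then_else_; _∨_)
open import Data.Fin using (Fin; _≟_)
open import Data.List using (List; []; _∷_; map; foldr; take; length; filter; allFin)
open import Data.List.Relation.Unary.All using (All)
open import Data.List.Relation.Unary.AllPairs using (AllPairs)
open import Data.Product using (_×_; _,_; proj₁; proj₂; swap)
open import Data.Sum using (_⊎_)
open import Relation.Nullary using (¬_)
open import Relation.Nullary.Decidable using (⌊_⌋)
open import Relation.Binary.PropositionalEquality using (_≡_; _≢_)

Edge : ℕ → Set
Edge n = Fin n × Fin n

SameEdge : ∀ {n} → Edge n → Edge n → Set
SameEdge e e' = (e ≡ e') ⊎ (e ≡ swap e')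

SimpleStream : ∀ {n} → List (Edge n) → Set
SimpleStream es = All (λ e → proj₁ e ≢ proj₂ e) es × AllPairs (λ e e' → ¬ SameEdge e e') es

deg : ∀ {n} → Fin n → List (Edge n) → ℕ
deg v [] = 0
deg v ((a , b) ∷ es) = (if ⌊ v ≟ a ⌋ ∨ ⌊ v ≟ b ⌋ then 1 else 0) + deg v es

maxDeg : ∀ {n} → List (Edge n) → ℕ
maxDeg {n} es = foldr _⊔_ 0 (map (λ v → deg v es) (allFin n))

assignedTo : ∀ {n t} → Fin t → List (Edge n × Fin t) → List (Edge n)
assignedTo i asg = map proj₁ (filter (λ p → proj₂ p ≟ i) asg)

-- An online (deterministic) assignment algorithm whose working memory is a
-- bit string: an initial memory content and a transition that, on reading
-- the arriving edge, irrevocably outputs an index in [t] and updates memory.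
record OnlineAlg (n t : ℕ) : Set where
  field
    init : List Bool
    step : List Bool → Edge n → List Bool × Fin t

runFrom : ∀ {n t} → OnlineAlg n t → List Bool → List (Edge n) → List Bool × List (Edge n × Fin t)
runFrom A s [] = s , []
runFrom A s (e ∷ es) with OnlineAlg.step A s e
... | s' , i with runFrom A s' es
...   | s'' , asg = s'' , ((e , i) ∷ asg)

run : ∀ {n t} → OnlineAlg n t → List (Edge n) → List Bool × List (Edge n × Fin t)
run A es = runFrom A (OnlineAlg.init A) es

memory : ∀ {n t} → OnlineAlg n t → List (Edge n) → ℕ
memory A es = length (proj₁ (run A es))

assignment : ∀ {n t} → OnlineAlg n t → List (Edge n) → List (Edge n × Fin t)
assignment A es = proj₂ (run A es)

-- deg_F ≤ (300 / log₂ n) · deg_G + 1, with real log₂ n, is equivalent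
-- (for n ≥ 2) to (deg_F − 1) · log₂ n ≤ 300 · deg_G, i.e. to
-- n ^ (deg_F ∸ 1) ≤ 2 ^ (300 · deg_G)  (exact in ℕ).
DegBound : ℕ → ℕ → ℕ → Set
DegBound n dF dG = n ^ (dF ∸ 1) ≤ 2 ^ (300 * dG)

{-# OPTIONS --safe #-}
module Submission where

-- Let L = ⌈log₂ n⌉ and q = ⌊L/4⌋. Give every vertex a codeword in {0,1}^(4L) so that any two
-- codewords differ in more than q + q coordinates; they exist by a greedy Gilbert–Varshamov count,
-- since a Hamming ball of radius 2q ≤ L/2 in {0,1}^(4L) has at most 2^(3L) points. Coordinate i
-- is the bipartition of F_i. Every vertex keeps a row of fewer than q + 1 colours. An arriving
-- edge ab gets a colour in which the codewords of a and b differ and which lies in neither row;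
-- it exists because the rows exclude at most q + q of the more than q + q candidates. The colour
-- is added to both rows, and a row is cleared when it fills up. Between two clearings a vertex
-- receives q + 1 edges of pairwise distinct colours, so deg_{F_i}(v) ≤ 1 + deg_G(v) / (q + 1),
-- which suffices since L ≤ 300 (q + 1). The memory is the n × 4L bit matrix of rows.

open import Algebra.Properties.CommutativeSemigroup using (interchange)
open import Data.Bool using (Bool; true; false; _xor_)
open import Data.Bool.Properties using (xor-comm; xor-same)
open import Data.Fin using (Fin; zero; suc; _≟_; fromℕ<)
open import Data.Fin.Properties using (any?)
open import Data.Fin.Subset
  using (Subset; inside; outside; _∈_; _∉_; ∣_∣; ⊥; ⁅_⁆; _∪_; _∩_; ∁; Nonempty)
open import Data.Fin.Subset.Properties
  using ( nonempty?; anySubset?; Empty-unique; ∣⊥∣≡0; ∪-identityˡ; drop-not-there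
        ; x∈⁅x⁆; x∈p∪q⁺; x∈p∩q⁻; x∈∁p⇒x∉p)
open import Data.List using (List; []; _∷_; _++_; [_]; length; map; filter; take)
open import Data.List.Properties using (length-++; filter-++; map-++)
open import Data.List.Relation.Unary.All using (All; []; _∷_)
open import Data.List.Relation.Unary.All.Properties using (take⁺)
open import Data.Nat
  using (ℕ; zero; suc; _+_; _*_; _∸_; _^_; _≤_; _<_; _≤?_; _<?_; z≤n; s≤s; s≤s⁻¹; NonZero; >-nonZero; ⌈_/2⌉)
open import Data.Nat.DivMod using (_/_; _%_; m*n/n≡m; /-monoˡ-≤; m/n*n≤m; m%n<n; m≡m%n+[m/n]*n)
open import Data.Nat.Induction using (<-wellFounded)
open import Data.Nat.Logarithm using (⌈log₂_⌉; ⌈log₂⌉-mono-≤)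
open import Data.Nat.Logarithm.Core using (⌈log2⌉)
open import Data.Nat.Properties hiding (_≟_)
open import Data.Nat.Tactic.RingSolver using (solve-∀)
open import Data.Product using (Σ; ∃; _×_; _,_; proj₁; proj₂; map₁)
open import Data.Sum using (_⊎_; inj₁; inj₂)
open import Data.Vec using (Vec; []; _∷_; here; zipWith; replicate; toList; lookup; _[_]%=_)
open import Data.Vec.Properties
  using ( zipWith-comm; lookup-zipWith; []=⇒lookup; lookup-replicate; length-toList
        ; lookup∘updateAt; lookup∘updateAt′)
open import Function using (_∘_)
open import Induction.WellFounded using (Acc; acc)
open import Level using (Level)
open import Relation.Binary.PropositionalEquality
  using (_≡_; _≢_; refl; sym; trans; cong; cong₂; subst; module ≡-Reasoning)
open import Relation.Nullary using (Dec; yes; no; ¬_; contradiction)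
open import Relation.Nullary.Decidable using (decidable-stable)
open import Relation.Unary using (Pred; Decidable; _⊆_)
open import Relation.Unary.Properties using (_∪?_; ∁?)

open import Defs

∣p∪q∣≤∣p∣+∣q∣ : ∀ {n} (p q : Subset n) → ∣ p ∪ q ∣ ≤ ∣ p ∣ + ∣ q ∣
∣p∪q∣≤∣p∣+∣q∣ []          []          = z≤n
∣p∪q∣≤∣p∣+∣q∣ (true  ∷ p) (true  ∷ q) = s≤s (≤-trans (∣p∪q∣≤∣p∣+∣q∣ p q) (+-monoʳ-≤ ∣ p ∣ (n≤1+n ∣ q ∣)))
∣p∪q∣≤∣p∣+∣q∣ (true  ∷ p) (false ∷ q) = s≤s (∣p∪q∣≤∣p∣+∣q∣ p q)
∣p∪q∣≤∣p∣+∣q∣ (false ∷ p) (true  ∷ q) = ≤-trans (s≤s (∣p∪q∣≤∣p∣+∣q∣ p q)) (≤-reflexive (sym (+-suc ∣ p ∣ ∣ q ∣)))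
∣p∪q∣≤∣p∣+∣q∣ (false ∷ p) (false ∷ q) = ∣p∪q∣≤∣p∣+∣q∣ p q

∣p∣≤∣p∩∁q∣+∣q∣ : ∀ {n} (p q : Subset n) → ∣ p ∣ ≤ ∣ p ∩ ∁ q ∣ + ∣ q ∣
∣p∣≤∣p∩∁q∣+∣q∣ []          []          = z≤n
∣p∣≤∣p∩∁q∣+∣q∣ (true  ∷ p) (true  ∷ q) = ≤-trans (s≤s (∣p∣≤∣p∩∁q∣+∣q∣ p q)) (≤-reflexive (sym (+-suc ∣ p ∩ ∁ q ∣ ∣ q ∣)))
∣p∣≤∣p∩∁q∣+∣q∣ (true  ∷ p) (false ∷ q) = s≤s (∣p∣≤∣p∩∁q∣+∣q∣ p q)
∣p∣≤∣p∩∁q∣+∣q∣ (false ∷ p) (true  ∷ q) = ≤-trans (∣p∣≤∣p∩∁q∣+∣q∣ p q) (+-monoʳ-≤ ∣ p ∩ ∁ q ∣ (n≤1+n ∣ q ∣))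
∣p∣≤∣p∩∁q∣+∣q∣ (false ∷ p) (false ∷ q) = ∣p∣≤∣p∩∁q∣+∣q∣ p q

∣⁅x⁆∪p∣≡1+∣p∣ : ∀ {n} {x : Fin n} {p : Subset n} → x ∉ p → ∣ ⁅ x ⁆ ∪ p ∣ ≡ suc ∣ p ∣
∣⁅x⁆∪p∣≡1+∣p∣ {x = zero}  {false ∷ p} x∉p = cong (suc ∘ ∣_∣) (∪-identityˡ p)
∣⁅x⁆∪p∣≡1+∣p∣ {x = zero}  {true  ∷ p} x∉p = contradiction here x∉p
∣⁅x⁆∪p∣≡1+∣p∣ {x = suc x} {false ∷ p} x∉p = ∣⁅x⁆∪p∣≡1+∣p∣ (drop-not-there x∉p)
∣⁅x⁆∪p∣≡1+∣p∣ {x = suc x} {true  ∷ p} x∉p = cong suc (∣⁅x⁆∪p∣≡1+∣p∣ (drop-not-there x∉p))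

∣p∣>0⇒Nonempty : ∀ {n} (p : Subset n) → 0 < ∣ p ∣ → Nonempty p
∣p∣>0⇒Nonempty {n} p 0<∣p∣ with nonempty? p
... | yes ne = ne
... | no ¬ne = contradiction (trans (cong ∣_∣ (Empty-unique ¬ne)) (∣⊥∣≡0 n)) (m<n⇒n≢0 0<∣p∣)

indicator : ∀ {a} {A : Set a} → Dec A → ℕ
indicator (yes _) = 1
indicator (no _)  = 0

count : ∀ {N ℓ} {P : Pred (Subset N) ℓ} → Decidable P → ℕ
count {zero}  P? = indicator (P? [])
count {suc N} P? = count (P? ∘ (inside ∷_)) + count (P? ∘ (outside ∷_))

module _ {ℓ₁ ℓ₂ : Level} where

  count-mono : ∀ {N} {P : Pred (Subset N) ℓ₁} {Q : Pred (Subset N) ℓ₂}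
               (P? : Decidable P) (Q? : Decidable Q) → P ⊆ Q → count P? ≤ count Q?
  count-mono {zero} P? Q? P⊆Q with P? [] | Q? []
  ... | yes p | yes _ = ≤-refl
  ... | yes p | no ¬q = contradiction (P⊆Q p) ¬q
  ... | no _  | _     = z≤n
  count-mono {suc N} P? Q? P⊆Q =
    +-mono-≤ (count-mono (P? ∘ (inside ∷_)) (Q? ∘ (inside ∷_)) P⊆Q)
             (count-mono (P? ∘ (outside ∷_)) (Q? ∘ (outside ∷_)) P⊆Q)

  count-∪ : ∀ {N} {P : Pred (Subset N) ℓ₁} {Q : Pred (Subset N) ℓ₂}
            (P? : Decidable P) (Q? : Decidable Q) → count (P? ∪? Q?) ≤ count P? + count Q?
  count-∪ {zero} P? Q? with P? [] | Q? []
  ... | yes _ | _     = s≤s z≤n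
  ... | no _  | yes _ = ≤-refl
  ... | no _  | no _  = z≤n
  count-∪ {suc N} {P = P} {Q} P? Q? = ≤-trans
    (+-mono-≤ (count-∪ P?ᵢ Q?ᵢ) (count-∪ P?ₒ Q?ₒ))
    (≤-reflexive (interchange +-commutativeSemigroup (count P?ᵢ) (count Q?ᵢ) (count P?ₒ) (count Q?ₒ)))
    where
    P?ᵢ P?ₒ : Decidable (λ w → P (_ ∷ w))
    P?ᵢ = P? ∘ (inside ∷_)
    P?ₒ = P? ∘ (outside ∷_)
    Q?ᵢ Q?ₒ : Decidable (λ w → Q (_ ∷ w))
    Q?ᵢ = Q? ∘ (inside ∷_)
    Q?ₒ = Q? ∘ (outside ∷_)

module _ {ℓ : Level} where

  count-∅ : ∀ {N} {P : Pred (Subset N) ℓ} (P? : Decidable P) → (∀ w → ¬ P w) → count P? ≡ 0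
  count-∅ {zero} P? ∅ with P? []
  ... | yes p = contradiction p (∅ [])
  ... | no _  = refl
  count-∅ {suc N} P? ∅ =
    cong₂ _+_ (count-∅ (P? ∘ (inside ∷_)) (∅ ∘ (inside ∷_))) (count-∅ (P? ∘ (outside ∷_)) (∅ ∘ (outside ∷_)))

  2^N≤count : ∀ {N} {P : Pred (Subset N) ℓ} (P? : Decidable P) → (∀ w → P w) → 2 ^ N ≤ count P?
  2^N≤count {zero} P? all with P? []
  ... | yes _ = ≤-refl
  ... | no ¬p = contradiction (all []) ¬p
  2^N≤count {suc N} P? all = ≤-trans (≤-reflexive (cong (2 ^ N +_) (+-identityʳ (2 ^ N))))
    (+-mono-≤ (2^N≤count (P? ∘ (inside ∷_)) (all ∘ (inside ∷_))) (2^N≤count (P? ∘ (outside ∷_)) (all ∘ (outside ∷_))))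

  count<2^N⇒∃¬ : ∀ {N} {P : Pred (Subset N) ℓ} (P? : Decidable P) → count P? < 2 ^ N → ∃ λ w → ¬ P w
  count<2^N⇒∃¬ P? count<2^N with anySubset? (∁? P?)
  ... | yes w = w
  ... | no ∄ = contradiction (2^N≤count P? (λ w → decidable-stable (P? w) (λ ¬p → ∄ (w , ¬p)))) (<⇒≱ count<2^N)

  count-∃ : ∀ {N m V} {P : Fin m → Pred (Subset N) ℓ} (P? : ∀ y → Decidable (P y)) →
            (∀ y → count (P? y) ≤ V) → count (λ w → any? (λ y → P? y w)) ≤ m * V
  count-∃ {N} {zero} P? bound = ≤-reflexive (count-∅ {N} (λ w → any? (λ y → P? y w)) λ w → λ ())
  count-∃ {N} {suc m} {V} {P} P? bound = begin
    count (λ w → any? (λ y → P? y w))  ≤⟨ count-mono (λ w → any? (λ y → P? y w)) (P? zero ∪? rest?) split ⟩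
    count (P? zero ∪? rest?)            ≤⟨ count-∪ (P? zero) rest? ⟩
    count (P? zero) + count rest?       ≤⟨ +-mono-≤ (bound zero) (count-∃ (P? ∘ suc) (bound ∘ suc)) ⟩
    V + m * V                           ∎
    where
    open ≤-Reasoning
    rest? : Decidable (λ w → ∃ λ y → P (suc y) w)
    rest? w = any? (λ y → P? (suc y) w)
    split : ∀ {w} → (∃ λ y → P y w) → P zero w ⊎ (∃ λ y → P (suc y) w)
    split (zero , p) = inj₁ p
    split (suc y , p) = inj₂ (y , p)

hamming : ∀ {N} → Subset N → Subset N → ℕ
hamming p q = ∣ zipWith _xor_ p q ∣

hamming-comm : ∀ {N} (p q : Subset N) → hamming p q ≡ hamming q p
hamming-comm p q = cong ∣_∣ (zipWith-comm xor-comm p q)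

-- volume N s = Σ_{k ≤ s} (N choose k), the size of a Hamming ball of radius s in {0,1}^N.
volume : ℕ → ℕ → ℕ
volume zero    s       = 1
volume (suc N) zero    = volume N zero
volume (suc N) (suc s) = volume N (suc s) + volume N s

0<volume : ∀ N s → 0 < volume N s
0<volume zero    s       = s≤s z≤n
0<volume (suc N) zero    = 0<volume N zero
0<volume (suc N) (suc s) = ≤-trans (0<volume N (suc s)) (m≤m+n (volume N (suc s)) (volume N s))

count-ball : ∀ {N} (c : Subset N) s → count (λ w → hamming c w ≤? s) ≤ volume N s

count-ball-∷ : ∀ {N} (c : Subset N) s →
  count (λ w → hamming c w ≤? s) + count (λ w → suc (hamming c w) ≤? s) ≤ volume (suc N) s
count-ball-∷ {N} c zero = begin
  count (λ w → hamming c w ≤? 0) + count (λ w → suc (hamming c w) ≤? 0)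
    ≡⟨ cong (count (λ w → hamming c w ≤? 0) +_) (count-∅ (λ w → suc (hamming c w) ≤? 0) λ w ()) ⟩
  count (λ w → hamming c w ≤? 0) + 0  ≡⟨ +-identityʳ _ ⟩
  count (λ w → hamming c w ≤? 0)      ≤⟨ count-ball c 0 ⟩
  volume N 0 ∎
  where open ≤-Reasoning
count-ball-∷ c (suc s) = +-mono-≤ (count-ball c (suc s))
  (≤-trans (count-mono (λ w → suc (hamming c w) ≤? suc s) (λ w → hamming c w ≤? s) s≤s⁻¹) (count-ball c s))

count-ball []          s = ≤-refl
count-ball (true  ∷ c) s = count-ball-∷ c s
count-ball (false ∷ c) s = ≤-trans (≤-reflexive (+-comm (count (λ w → suc (hamming c w) ≤? s)) _)) (count-ball-∷ c s)

-- Σ_{k ≤ s} (N choose k) ≤ a^s · Σ_k (N choose k) a^(-k) = a^s (1 + 1/a)^N.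
volume-bound : ∀ a .{{_ : NonZero a}} N s → volume N s * a ^ N ≤ a ^ s * suc a ^ N
volume-bound a zero s = ≤-trans (m^n>0 a s) (≤-reflexive (sym (*-identityʳ (a ^ s))))
volume-bound a (suc N) zero = begin
  volume N 0 * (a * a ^ N)   ≡⟨ x*[y*z]≡y*[x*z] (volume N 0) a (a ^ N) ⟩
  a * (volume N 0 * a ^ N)   ≤⟨ *-monoʳ-≤ a (volume-bound a N 0) ⟩
  a * (1 * suc a ^ N)        ≡⟨ cong (a *_) (*-identityˡ (suc a ^ N)) ⟩
  a * suc a ^ N              ≤⟨ m≤n+m (a * suc a ^ N) (suc a ^ N) ⟩
  suc a ^ suc N              ≡⟨ *-identityˡ (suc a ^ suc N) ⟨
  1 * suc a ^ suc N          ∎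
  where
  open ≤-Reasoning
  x*[y*z]≡y*[x*z] : ∀ x y z → x * (y * z) ≡ y * (x * z)
  x*[y*z]≡y*[x*z] = solve-∀
volume-bound a (suc N) (suc s) = begin
  (volume N (suc s) + volume N s) * (a * a ^ N)
    ≡⟨ distrib (volume N (suc s)) (volume N s) a (a ^ N) ⟩
  a * (volume N (suc s) * a ^ N) + a * (volume N s * a ^ N)
    ≤⟨ +-mono-≤ (*-monoʳ-≤ a (volume-bound a N (suc s))) (*-monoʳ-≤ a (volume-bound a N s)) ⟩
  a * (a * a ^ s * suc a ^ N) + a * (a ^ s * suc a ^ N)
    ≡⟨ collect a (a ^ s) (suc a ^ N) ⟩
  a * a ^ s * (suc a * suc a ^ N) ∎
  where
  open ≤-Reasoning
  distrib : ∀ u v x y → (u + v) * (x * y) ≡ x * (u * y) + x * (v * y)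
  distrib = solve-∀
  collect : ∀ x y z → x * (x * y * z) + x * (y * z) ≡ x * y * ((1 + x) * z)
  collect = solve-∀

volume-4L : ∀ L s → 2 * s ≤ L → volume (4 * L) s ≤ 2 ^ (3 * L)
volume-4L L s 2s≤L = *-cancelʳ-≤ (volume (4 * L) s) (2 ^ (3 * L)) (4 ^ (4 * L)) {{m^n≢0 4 (4 * L)}} (begin
  volume (4 * L) s * 4 ^ (4 * L)  ≤⟨ volume-bound 4 (4 * L) s ⟩
  4 ^ s * 5 ^ (4 * L)             ≡⟨ cong₂ _*_ (^-*-assoc 2 2 s) (sym (^-*-assoc 5 4 L)) ⟩
  2 ^ (2 * s) * (5 ^ 4) ^ L       ≤⟨ *-monoʳ-≤ (2 ^ (2 * s)) (^-monoˡ-≤ L 5^4≤2^10) ⟩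
  2 ^ (2 * s) * (2 ^ 10) ^ L      ≡⟨ cong (2 ^ (2 * s) *_) (^-*-assoc 2 10 L) ⟩
  2 ^ (2 * s) * 2 ^ (10 * L)      ≡⟨ ^-distribˡ-+-* 2 (2 * s) (10 * L) ⟨
  2 ^ (2 * s + 10 * L)            ≤⟨ ^-monoʳ-≤ 2 (+-monoˡ-≤ (10 * L) 2s≤L) ⟩
  2 ^ (L + 10 * L)                ≡⟨ cong (2 ^_) (exponents L) ⟩
  2 ^ (3 * L + 2 * (4 * L))       ≡⟨ ^-distribˡ-+-* 2 (3 * L) (2 * (4 * L)) ⟩
  2 ^ (3 * L) * 2 ^ (2 * (4 * L)) ≡⟨ cong (2 ^ (3 * L) *_) (^-*-assoc 2 2 (4 * L)) ⟨
  2 ^ (3 * L) * 4 ^ (4 * L)       ∎)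
  where
  open ≤-Reasoning
  5^4≤2^10 : 5 ^ 4 ≤ 2 ^ 10
  5^4≤2^10 = ≤ᵇ⇒≤ (5 ^ 4) (2 ^ 10) _
  exponents : ∀ L → L + 10 * L ≡ 3 * L + 2 * (4 * L)
  exponents = solve-∀

Separated : ∀ {m N} → ℕ → (Fin m → Subset N) → Set
Separated s word = ∀ x y → x ≢ y → s < hamming (word x) (word y)

-- While the balls around the m words chosen so far leave a word uncovered, it extends the code.
separated-code : ∀ N s m → m * volume N s ≤ 2 ^ N → Σ (Fin m → Subset N) (Separated s)
separated-code N s zero    _       = (λ ()) , (λ ())
separated-code N s (suc m) covered = word , separated
  where
  previous : Σ (Fin m → Subset N) (Separated s)
  previous = separated-code N s m (≤-trans (*-monoˡ-≤ (volume N s) (n≤1+n m)) covered)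
  old : Fin m → Subset N
  old = proj₁ previous
  near? : Decidable (λ w → ∃ λ y → hamming (old y) w ≤ s)
  near? w = any? (λ y → hamming (old y) w ≤? s)
  few-near : count near? < 2 ^ N
  few-near = begin-strict
    count near?         ≤⟨ count-∃ (λ y w → hamming (old y) w ≤? s) (λ y → count-ball (old y) s) ⟩
    m * volume N s      <⟨ m<n+m (m * volume N s) (0<volume N s) ⟩
    suc m * volume N s  ≤⟨ covered ⟩
    2 ^ N               ∎
    where open ≤-Reasoning
  new : ∃ λ w → ¬ (∃ λ y → hamming (old y) w ≤ s)
  new = count<2^N⇒∃¬ near? few-near
  far : ∀ y → s < hamming (old y) (proj₁ new)
  far y = ≰⇒> (λ near → proj₂ new (y , near))
  word : Fin (suc m) → Subset N
  word zero    = proj₁ new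
  word (suc y) = old y
  separated : Separated s word
  separated zero    zero    0≢0 = contradiction refl 0≢0
  separated zero    (suc y) _   = subst (s <_) (hamming-comm (old y) (proj₁ new)) (far y)
  separated (suc x) zero    _   = far x
  separated (suc x) (suc y) x≢y = proj₂ previous x y (x≢y ∘ cong suc)

-- Missing bits are read as false; memories written by encode never lack any.
readRow : ∀ t → List Bool → Vec Bool t × List Bool
readRow zero    bs       = [] , bs
readRow (suc t) []       = replicate (suc t) false , []
readRow (suc t) (b ∷ bs) = map₁ (b ∷_) (readRow t bs)

encode : ∀ {n t} → Vec (Vec Bool t) n → List Bool
encode []      = []
encode (r ∷ M) = toList r ++ encode M

decode : ∀ {n t} → List Bool → Vec (Vec Bool t) n
decode {zero}      bs = []
decode {suc n} {t} bs = proj₁ (readRow t bs) ∷ decode (proj₂ (readRow t bs))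

readRow-toList : ∀ {t} (r : Vec Bool t) bs → readRow t (toList r ++ bs) ≡ (r , bs)
readRow-toList []      bs = refl
readRow-toList (b ∷ r) bs = cong (map₁ (b ∷_)) (readRow-toList r bs)

decode-encode : ∀ {n t} (M : Vec (Vec Bool t) n) → decode (encode M) ≡ M
decode-encode []      = refl
decode-encode (r ∷ M) rewrite readRow-toList r (encode M) = cong (r ∷_) (decode-encode M)

length-encode : ∀ {n t} (M : Vec (Vec Bool t) n) → length (encode M) ≡ n * t
length-encode []      = refl
length-encode (r ∷ M) = trans (length-++ (toList r)) (cong₂ _+_ (length-toList r) (length-encode M))

-- The row r of a vertex holds the colours used at it since the row was last cleared, which
-- happens whenever it would reach K colours; epoch counts the clearings. For a vertex of degree d
-- in G and f j in F_j, Tracks says that every colour is used at most once per epoch.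
module _ {t : ℕ} (K : ℕ) where

  mark : Fin t → Subset t → Subset t
  mark i r with ∣ ⁅ i ⁆ ∪ r ∣ <? K
  ... | yes _ = ⁅ i ⁆ ∪ r
  ... | no  _ = ⊥

  record Tracks (r : Subset t) (d : ℕ) (f : Fin t → ℕ) : Set where
    field
      epoch         : ℕ
      d≡epoch*K+∣r∣ : d ≡ epoch * K + ∣ r ∣
      ∣r∣<K         : ∣ r ∣ < K
      f≤1+epoch     : ∀ j → f j ≤ suc epoch
      f≤epoch       : ∀ j → j ∉ r → f j ≤ epoch

  Tracks-resp : ∀ {r r' d d' f f'} → r ≡ r' → d ≡ d' → (∀ j → f j ≡ f' j) → Tracks r d f → Tracks r' d' f'
  Tracks-resp refl refl f≗f' T = record
    { epoch = epoch ; d≡epoch*K+∣r∣ = d≡epoch*K+∣r∣ ; ∣r∣<K = ∣r∣<K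
    ; f≤1+epoch = λ j → subst (_≤ suc epoch) (f≗f' j) (f≤1+epoch j)
    ; f≤epoch = λ j j∉r → subst (_≤ epoch) (f≗f' j) (f≤epoch j j∉r) }
    where open Tracks T

  Tracks-⊥ : 0 < K → Tracks ⊥ 0 (λ _ → 0)
  Tracks-⊥ 0<K = record
    { epoch = 0 ; d≡epoch*K+∣r∣ = sym (∣⊥∣≡0 t) ; ∣r∣<K = subst (_< K) (sym (∣⊥∣≡0 t)) 0<K
    ; f≤1+epoch = λ _ → z≤n ; f≤epoch = λ _ _ → z≤n }

  Tracks-bound : ∀ {r d f} .{{_ : NonZero K}} → Tracks r d f → ∀ j → f j ≤ suc (d / K)
  Tracks-bound {d = d} T j = ≤-trans (f≤1+epoch j) (s≤s (begin
    epoch             ≡⟨ m*n/n≡m epoch K ⟨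
    epoch * K / K     ≤⟨ /-monoˡ-≤ K (subst (epoch * K ≤_) (sym d≡epoch*K+∣r∣) (m≤m+n (epoch * K) _)) ⟩
    d / K             ∎))
    where
    open Tracks T
    open ≤-Reasoning

  private
    marked-f≤ : ∀ {r d} {f f' : Fin t → ℕ} i → i ∉ r → f' i ≡ suc (f i) → (∀ j → j ≢ i → f' j ≡ f j) →
                (T : Tracks r d f) → ∀ j → f' j ≤ suc (Tracks.epoch T)
    marked-f≤ i i∉r f'i≡ f'j≡ T j with j ≟ i
    ... | yes refl = subst (_≤ suc epoch) (sym f'i≡) (s≤s (f≤epoch i i∉r))   where open Tracks T
    ... | no j≢i   = subst (_≤ suc epoch) (sym (f'j≡ j j≢i)) (f≤1+epoch j)   where open Tracks T

  Tracks-mark : ∀ {r d} {f f' : Fin t → ℕ} i → i ∉ r → f' i ≡ suc (f i) → (∀ j → j ≢ i → f' j ≡ f j) →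
                Tracks r d f → Tracks (mark i r) (suc d) f'
  Tracks-mark {r} {d} {f} {f'} i i∉r f'i≡ f'j≡ T with ∣ ⁅ i ⁆ ∪ r ∣ <? K
  ... | yes grown<K = record
    { epoch         = epoch
    ; d≡epoch*K+∣r∣ = trans (cong suc d≡epoch*K+∣r∣) (trans (sym (+-suc (epoch * K) ∣ r ∣)) (cong (epoch * K +_) (sym ∣grown∣)))
    ; ∣r∣<K         = grown<K
    ; f≤1+epoch     = marked-f≤ {f' = f'} i i∉r f'i≡ f'j≡ T
    ; f≤epoch       = λ j j∉grown → subst (_≤ epoch) (sym (f'j≡ j (j∉grown ∘ ∈-⁅i⁆))) (f≤epoch j (j∉grown ∘ ∈-r))
    }
    where
    open Tracks T
    ∣grown∣ : ∣ ⁅ i ⁆ ∪ r ∣ ≡ suc ∣ r ∣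
    ∣grown∣ = ∣⁅x⁆∪p∣≡1+∣p∣ i∉r
    ∈-⁅i⁆ : ∀ {j} → j ≡ i → j ∈ ⁅ i ⁆ ∪ r
    ∈-⁅i⁆ refl = x∈p∪q⁺ (inj₁ (x∈⁅x⁆ i))
    ∈-r : ∀ {j} → j ∈ r → j ∈ ⁅ i ⁆ ∪ r
    ∈-r j∈r = x∈p∪q⁺ (inj₂ j∈r)
  ... | no ¬grown<K = record
    { epoch         = suc epoch
    ; d≡epoch*K+∣r∣ = d≡
    ; ∣r∣<K         = subst (_< K) (sym (∣⊥∣≡0 t)) (≤-trans (s≤s z≤n) ∣r∣<K)
    ; f≤1+epoch     = λ j → m≤n⇒m≤1+n (marked-f≤ {f' = f'} i i∉r f'i≡ f'j≡ T j)
    ; f≤epoch       = λ j _ → marked-f≤ {f' = f'} i i∉r f'i≡ f'j≡ T j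
    }
    where
    open Tracks T
    full : suc ∣ r ∣ ≡ K
    full = ≤-antisym ∣r∣<K (≮⇒≥ (¬grown<K ∘ subst (_< K) (sym (∣⁅x⁆∪p∣≡1+∣p∣ i∉r))))
    d≡ : suc d ≡ suc epoch * K + ∣ ⊥ {t} ∣
    d≡ = begin
      suc d                     ≡⟨ cong suc d≡epoch*K+∣r∣ ⟩
      suc (epoch * K + ∣ r ∣)   ≡⟨ +-suc (epoch * K) ∣ r ∣ ⟨
      epoch * K + suc ∣ r ∣     ≡⟨ cong (epoch * K +_) full ⟩
      epoch * K + K             ≡⟨ +-comm (epoch * K) K ⟩
      suc epoch * K             ≡⟨ +-identityʳ (suc epoch * K) ⟨
      suc epoch * K + 0         ≡⟨ cong (suc epoch * K +_) (∣⊥∣≡0 t) ⟨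
      suc epoch * K + ∣ ⊥ {t} ∣ ∎
      where open ≡-Reasoning

pick : ∀ {t} → Fin t → Subset t → Fin t
pick default p with nonempty? p
... | yes (i , _) = i
... | no  _       = default

pick-∈ : ∀ {t} (default : Fin t) {p : Subset t} → Nonempty p → pick default p ∈ p
pick-∈ default {p} ne with nonempty? p
... | yes (_ , i∈p) = i∈p
... | no  empty     = contradiction ne empty

∈-xor⇒≢ : ∀ {t} {p q : Subset t} {i} → i ∈ zipWith _xor_ p q → lookup p i ≢ lookup q i
∈-xor⇒≢ {p = p} {q} {i} i∈p⊕q p≡q = contradiction true≡false λ ()
  where
  open ≡-Reasoning
  true≡false : true ≡ false
  true≡false = begin
    true                             ≡⟨ []=⇒lookup i∈p⊕q ⟨
    lookup (zipWith _xor_ p q) i     ≡⟨ lookup-zipWith _xor_ i p q ⟩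
    lookup p i xor lookup q i        ≡⟨ cong (_xor lookup q i) p≡q ⟩
    lookup q i xor lookup q i        ≡⟨ xor-same (lookup q i) ⟩
    false                            ∎

deg-++ : ∀ {n} (v : Fin n) xs ys → deg v (xs ++ ys) ≡ deg v xs + deg v ys
deg-++ v []            ys = refl
deg-++ v ((a , b) ∷ xs) ys = trans (cong (_ +_) (deg-++ v xs ys)) (sym (+-assoc _ (deg v xs) (deg v ys)))

assignedTo-++ : ∀ {n t} (j : Fin t) (xs ys : List (Edge n × Fin t)) →
                assignedTo j (xs ++ ys) ≡ assignedTo j xs ++ assignedTo j ys
assignedTo-++ j xs ys = trans (cong (map proj₁) (filter-++ (λ p → proj₂ p ≟ j) xs ys)) (map-++ proj₁ (filter (λ p → proj₂ p ≟ j) xs) (filter (λ p → proj₂ p ≟ j) ys))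

assignedTo-hit : ∀ {n t} (e : Edge n) (i : Fin t) → assignedTo i [ (e , i) ] ≡ [ e ]
assignedTo-hit e i with i ≟ i
... | yes _   = refl
... | no  i≢i = contradiction refl i≢i

assignedTo-miss : ∀ {n t} (e : Edge n) {i j : Fin t} → i ≢ j → assignedTo j [ (e , i) ] ≡ []
assignedTo-miss e {i} {j} i≢j with i ≟ j
... | yes i≡j = contradiction i≡j i≢j
... | no  _   = refl

deg-assignedTo-[e,i]≤deg-[e] : ∀ {n t} (v : Fin n) (e : Edge n) (i j : Fin t) → deg v (assignedTo j [ (e , i) ]) ≤ deg v [ e ]
deg-assignedTo-[e,i]≤deg-[e] v e i j with i ≟ j
... | yes _ = ≤-refl
... | no  _ = z≤n

deg-left : ∀ {n} (a b : Fin n) → deg a [ (a , b) ] ≡ 1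
deg-left a b with a ≟ a
... | yes _   = refl
... | no  a≢a = contradiction refl a≢a

deg-right : ∀ {n} (a b : Fin n) → deg b [ (a , b) ] ≡ 1
deg-right a b with b ≟ a | b ≟ b
... | yes _ | _       = refl
... | no  _ | yes _   = refl
... | no  _ | no  b≢b = contradiction refl b≢b

deg-other : ∀ {n} {v a b : Fin n} → v ≢ a → v ≢ b → deg v [ (a , b) ] ≡ 0
deg-other {v = v} {a} {b} v≢a v≢b with v ≟ a | v ≟ b
... | yes v≡a | _       = contradiction v≡a v≢a
... | no  _   | yes v≡b = contradiction v≡b v≢b
... | no  _   | no  _   = refl

module Greedy {n t : ℕ} (q : ℕ) (default : Fin t) (word : Fin n → Subset t)
              (separated : Separated (q + q) word) where

  side : Fin t → Fin n → Bool
  side i v = lookup (word v) i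

  Memory : Set
  Memory = Vec (Subset t) n

  free : Memory → Edge n → Subset t
  free M (a , b) = zipWith _xor_ (word a) (word b) ∩ ∁ (lookup M a ∪ lookup M b)

  colour : Memory → Edge n → Fin t
  colour M e = pick default (free M e)

  recolour : Memory → Edge n → Memory
  recolour M (a , b) = M [ a ]%= mark (suc q) i [ b ]%= mark (suc q) i
    where i = colour M (a , b)

  algorithm : OnlineAlg n t
  algorithm = record
    { init = encode (replicate n (⊥ {t}))
    ; step = λ s e → encode (recolour (decode s) e) , colour (decode s) e
    }

  Tracked : Memory → (Fin n → ℕ) → (Fin n → Fin t → ℕ) → Set
  Tracked M d f = ∀ v → Tracks (suc q) (lookup M v) (d v) (f v)

  ProperlyColoured : Edge n × Fin t → Set
  ProperlyColoured ((a , b) , i) = side i a ≢ side i b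

  colour-free : ∀ {M d f a b} → a ≢ b → Tracked M d f → colour M (a , b) ∈ free M (a , b)
  colour-free {M} {a = a} {b} a≢b T = pick-∈ default (∣p∣>0⇒Nonempty (free M (a , b)) (+-cancelʳ-< (q + q) 0 _ (begin-strict
    q + q                                  <⟨ separated a b a≢b ⟩
    ∣ D ∣                                  ≤⟨ ∣p∣≤∣p∩∁q∣+∣q∣ D (Ma ∪ Mb) ⟩
    ∣ free M (a , b) ∣ + ∣ Ma ∪ Mb ∣       ≤⟨ +-monoʳ-≤ ∣ free M (a , b) ∣ (∣p∪q∣≤∣p∣+∣q∣ Ma Mb) ⟩
    ∣ free M (a , b) ∣ + (∣ Ma ∣ + ∣ Mb ∣) ≤⟨ +-monoʳ-≤ ∣ free M (a , b) ∣ (+-mono-≤ (row≤q a) (row≤q b)) ⟩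
    ∣ free M (a , b) ∣ + (q + q)           ∎)))
    where
    open ≤-Reasoning
    D Ma Mb : Subset t
    D  = zipWith _xor_ (word a) (word b)
    Ma = lookup M a
    Mb = lookup M b
    row≤q : ∀ v → ∣ lookup M v ∣ ≤ q
    row≤q v = s≤s⁻¹ (Tracks.∣r∣<K (T v))

  recolour-tracks : ∀ {M d f a b} → a ≢ b → Tracked M d f →
    Tracked (recolour M (a , b)) (λ v → d v + deg v [ (a , b) ])
            (λ v j → f v j + deg v (assignedTo j [ ((a , b) , colour M (a , b)) ]))
  recolour-tracks {M} {d} {f} {a} {b} a≢b T v = by-cases v (v ≟ a) (v ≟ b)
    where
    e : Edge n
    e = (a , b)
    i : Fin t
    i = colour M e
    M′ : Memory
    M′ = recolour M e
    i∉Ma∪Mb : i ∉ lookup M a ∪ lookup M b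
    i∉Ma∪Mb = x∈∁p⇒x∉p (proj₂ (x∈p∩q⁻ (zipWith _xor_ (word a) (word b)) _ (colour-free {M} a≢b T)))
    Goal : Fin n → Set
    Goal v = Tracks (suc q) (lookup M′ v) (d v + deg v [ e ]) (λ j → f v j + deg v (assignedTo j [ (e , i) ]))
    marked : ∀ v → deg v [ e ] ≡ 1 → i ∉ lookup M v → lookup M′ v ≡ mark (suc q) i (lookup M v) → Goal v
    marked v deg≡1 i∉Mv row≡ = Tracks-resp (suc q) (sym row≡) d≡ (λ _ → refl) (Tracks-mark (suc q) i i∉Mv f′i≡ f′j≡ (T v))
      where
      d≡ : suc (d v) ≡ d v + deg v [ e ]
      d≡ = trans (+-comm 1 (d v)) (cong (d v +_) (sym deg≡1))
      f′i≡ : f v i + deg v (assignedTo i [ (e , i) ]) ≡ suc (f v i)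
      f′i≡ = begin
        f v i + deg v (assignedTo i [ (e , i) ]) ≡⟨ cong (λ es → f v i + deg v es) {x = assignedTo i [ (e , i) ]} (assignedTo-hit e i) ⟩
        f v i + deg v [ e ]                       ≡⟨ cong (f v i +_) deg≡1 ⟩
        f v i + 1                                 ≡⟨ +-comm (f v i) 1 ⟩
        suc (f v i)                               ∎
        where open ≡-Reasoning
      f′j≡ : ∀ j → j ≢ i → f v j + deg v (assignedTo j [ (e , i) ]) ≡ f v j
      f′j≡ j j≢i = trans (cong (λ es → f v j + deg v es) {x = assignedTo j [ (e , i) ]} (assignedTo-miss e (j≢i ∘ sym)))
                         (+-identityʳ (f v j))
    unmarked : ∀ v → deg v [ e ] ≡ 0 → lookup M′ v ≡ lookup M v → Goal v
    unmarked v deg≡0 row≡ = Tracks-resp (suc q) (sym row≡) d≡ f≡ (T v)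
      where
      d≡ : d v ≡ d v + deg v [ e ]
      d≡ = trans (sym (+-identityʳ (d v))) (cong (d v +_) (sym deg≡0))
      deg-assigned≡0 : ∀ j → deg v (assignedTo j [ (e , i) ]) ≡ 0
      deg-assigned≡0 j = n≤0⇒n≡0 (subst (deg v (assignedTo j [ (e , i) ]) ≤_) deg≡0 (deg-assignedTo-[e,i]≤deg-[e] v e i j))
      f≡ : ∀ j → f v j ≡ f v j + deg v (assignedTo j [ (e , i) ])
      f≡ j = trans (sym (+-identityʳ (f v j))) (cong (f v j +_) (sym (deg-assigned≡0 j)))
    by-cases : ∀ v → Dec (v ≡ a) → Dec (v ≡ b) → Goal v
    by-cases v (yes refl) _ = marked a (deg-left a b) (i∉Ma∪Mb ∘ x∈p∪q⁺ ∘ inj₁)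
      (trans (lookup∘updateAt′ a b a≢b (M [ a ]%= mark (suc q) i)) (lookup∘updateAt a M))
    by-cases v (no _) (yes refl) = marked b (deg-right a b) (i∉Ma∪Mb ∘ x∈p∪q⁺ ∘ inj₂)
      (trans (lookup∘updateAt b (M [ a ]%= mark (suc q) i)) (cong (mark (suc q) i) (lookup∘updateAt′ b a (a≢b ∘ sym) M)))
    by-cases v (no v≢a) (no v≢b) = unmarked v (deg-other v≢a v≢b)
      (trans (lookup∘updateAt′ v b v≢b (M [ a ]%= mark (suc q) i)) (lookup∘updateAt′ v a v≢a M))

  run-length : ∀ es s → length s ≡ n * t → length (proj₁ (runFrom algorithm s es)) ≡ n * t
  run-length []       s ∣s∣≡ = ∣s∣≡
  run-length (e ∷ es) s _    = run-length es _ (length-encode (recolour (decode s) e))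

  run-tracks : ∀ es → All (λ e → proj₁ e ≢ proj₂ e) es → ∀ s d f → Tracked (decode s) d f →
    All ProperlyColoured (proj₂ (runFrom algorithm s es))
    × Tracked (decode (proj₁ (runFrom algorithm s es))) (λ v → d v + deg v es)
              (λ v j → f v j + deg v (assignedTo j (proj₂ (runFrom algorithm s es))))
  run-tracks [] [] s d f T = [] , λ v → Tracks-resp (suc q) refl (sym (+-identityʳ (d v))) (λ j → sym (+-identityʳ (f v j))) (T v)
  run-tracks ((a , b) ∷ es) (a≢b ∷ loopless) s d f T =
    proper ∷ proj₁ IH , λ v → Tracks-resp (suc q) refl (d≡ v) (f≡ v) (proj₂ IH v)
    where
    e : Edge n
    e = (a , b)
    M : Memory
    M = decode s
    i : Fin t
    i = colour M e
    d′ : Fin n → ℕ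
    d′ v = d v + deg v [ e ]
    f′ : Fin n → Fin t → ℕ
    f′ v j = f v j + deg v (assignedTo j [ (e , i) ])
    asg : List (Edge n × Fin t)
    asg = proj₂ (runFrom algorithm (encode (recolour M e)) es)
    IH : All ProperlyColoured asg × Tracked (decode (proj₁ (runFrom algorithm (encode (recolour M e)) es)))
                                          (λ v → d′ v + deg v es) (λ v j → f′ v j + deg v (assignedTo j asg))
    IH = run-tracks es loopless (encode (recolour M e)) d′ f′
           (subst (λ M′ → Tracked M′ d′ f′) (sym (decode-encode (recolour M e))) (recolour-tracks {M} a≢b T))
    proper : ProperlyColoured (e , i)
    proper = ∈-xor⇒≢ (proj₁ (x∈p∩q⁻ (zipWith _xor_ (word a) (word b)) _ (colour-free {M} a≢b T)))
    d≡ : ∀ v → d′ v + deg v es ≡ d v + deg v (e ∷ es)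
    d≡ v = trans (+-assoc (d v) (deg v [ e ]) (deg v es)) (cong (d v +_) (sym (deg-++ v [ e ] es)))
    f≡ : ∀ v j → f′ v j + deg v (assignedTo j asg) ≡ f v j + deg v (assignedTo j ((e , i) ∷ asg))
    f≡ v j = trans (+-assoc (f v j) (deg v (assignedTo j [ (e , i) ])) (deg v (assignedTo j asg)))
               (cong (f v j +_) (sym (trans (cong (deg v) (assignedTo-++ j [ (e , i) ] asg)) (deg-++ v (assignedTo j [ (e , i) ]) (assignedTo j asg)))))

  initial-tracked : Tracked (decode (OnlineAlg.init algorithm)) (λ _ → 0) (λ _ _ → 0)
  initial-tracked v = subst (λ r → Tracks (suc q) r 0 (λ _ → 0))
    (sym (trans (cong (λ M → lookup M v) (decode-encode (replicate n ⊥))) (lookup-replicate v ⊥)))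
    (Tracks-⊥ (suc q) (s≤s z≤n))

  greedy-proper : ∀ xs → All (λ e → proj₁ e ≢ proj₂ e) xs → All ProperlyColoured (assignment algorithm xs)
  greedy-proper xs loopless = proj₁ (run-tracks xs loopless _ _ _ initial-tracked)

  greedy-degree : ∀ xs → All (λ e → proj₁ e ≢ proj₂ e) xs → ∀ i v →
                  deg v (assignedTo i (assignment algorithm xs)) ≤ suc (deg v xs / suc q)
  greedy-degree xs loopless i v = Tracks-bound (suc q) (proj₂ (run-tracks xs loopless _ _ _ initial-tracked) v) i

  greedy-memory : ∀ xs → memory algorithm xs ≡ n * t
  greedy-memory xs = run-length xs _ (length-encode (replicate n ⊥))

n≤2^⌈log2⌉n : ∀ n (acc : Acc _<_ n) → n ≤ 2 ^ ⌈log2⌉ n acc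
n≤2^⌈log2⌉n 0             _        = z≤n
n≤2^⌈log2⌉n 1             _        = ≤-refl
n≤2^⌈log2⌉n (suc (suc m)) (acc rs) = begin
  2 + m                 ≤⟨ +-monoʳ-≤ 2 (≤-trans (≤-reflexive (sym (⌊n/2⌋+⌈n/2⌉≡n m))) (+-monoˡ-≤ h (⌊n/2⌋≤⌈n/2⌉ m))) ⟩
  2 + (h + h)           ≡⟨ cong suc (+-suc h h) ⟨
  suc h + suc h         ≤⟨ +-mono-≤ ih ih ⟩
  2 ^ X + 2 ^ X         ≡⟨ cong (2 ^ X +_) (+-identityʳ (2 ^ X)) ⟨
  2 ^ suc X             ∎
  where
  open ≤-Reasoning
  h X : ℕ
  h = ⌈ m /2⌉
  X = ⌈log2⌉ (suc h) (rs (⌈n/2⌉<n m))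
  ih : suc h ≤ 2 ^ X
  ih = n≤2^⌈log2⌉n (suc h) (rs (⌈n/2⌉<n m))

n≤2^⌈log₂n⌉ : ∀ n → n ≤ 2 ^ ⌈log₂ n ⌉
n≤2^⌈log₂n⌉ n = n≤2^⌈log2⌉n n (<-wellFounded n)

degBound : ∀ n .{{_ : NonZero n}} L K .{{_ : NonZero K}} → n ≤ 2 ^ L → L ≤ 300 * K →
           ∀ f d → f ≤ suc (d / K) → DegBound n f d
degBound n L K n≤2^L L≤300K f d f≤ = begin
  n ^ (f ∸ 1)          ≤⟨ ^-monoʳ-≤ n (∸-monoˡ-≤ 1 f≤) ⟩
  n ^ (d / K)          ≤⟨ ^-monoˡ-≤ (d / K) n≤2^L ⟩
  (2 ^ L) ^ (d / K)    ≡⟨ ^-*-assoc 2 L (d / K) ⟩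
  2 ^ (L * (d / K))    ≤⟨ ^-monoʳ-≤ 2 exponent≤ ⟩
  2 ^ (300 * d)        ∎
  where
  open ≤-Reasoning
  exponent≤ : L * (d / K) ≤ 300 * d
  exponent≤ = begin
    L * (d / K)          ≤⟨ *-monoˡ-≤ (d / K) L≤300K ⟩
    300 * K * (d / K)    ≡⟨ *-assoc 300 K (d / K) ⟩
    300 * (K * (d / K))  ≡⟨ cong (300 *_) (*-comm K (d / K)) ⟩
    300 * (d / K * K)    ≤⟨ *-monoʳ-≤ 300 (m/n*n≤m d K) ⟩
    300 * d              ∎

module Parameters (n : ℕ) (2≤n : 2 ≤ n) where

  L : ℕ
  L = ⌈log₂ n ⌉

  q : ℕ
  q = L / 4

  default : Fin (4 * L)
  default = fromℕ< (≤-trans (⌈log₂⌉-mono-≤ 2≤n) (m≤n*m L 4))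

  2[q+q]≤L : 2 * (q + q) ≤ L
  2[q+q]≤L = ≤-trans (≤-reflexive (2[x+x]≡x*4 q)) (m/n*n≤m L 4)
    where
    2[x+x]≡x*4 : ∀ x → 2 * (x + x) ≡ x * 4
    2[x+x]≡x*4 = solve-∀

  L≤300[1+q] : L ≤ 300 * suc q
  L≤300[1+q] = begin
    L                ≡⟨ m≡m%n+[m/n]*n L 4 ⟩
    L % 4 + q * 4    ≤⟨ +-monoˡ-≤ (q * 4) (<⇒≤ (m%n<n L 4)) ⟩
    4 + q * 4        ≡⟨ *-comm (suc q) 4 ⟩
    4 * suc q        ≤⟨ *-monoˡ-≤ (suc q) (m≤m+n 4 296) ⟩
    300 * suc q      ∎
    where open ≤-Reasoning

  few-words : n * volume (4 * L) (q + q) ≤ 2 ^ (4 * L)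
  few-words = begin
    n * volume (4 * L) (q + q)  ≤⟨ *-mono-≤ (n≤2^⌈log₂n⌉ n) (volume-4L L (q + q) 2[q+q]≤L) ⟩
    2 ^ L * 2 ^ (3 * L)         ≡⟨ ^-distribˡ-+-* 2 L (3 * L) ⟨
    2 ^ (4 * L)                 ∎
    where open ≤-Reasoning

  code : Σ (Fin n → Subset (4 * L)) (Separated (q + q))
  code = separated-code (4 * L) (q + q) n few-words

  open Greedy q default (proj₁ code) (proj₂ code) public

  degree-bound : ∀ xs → All (λ e → proj₁ e ≢ proj₂ e) xs → ∀ i v →
                 DegBound n (deg v (assignedTo i (assignment algorithm xs))) (deg v xs)
  degree-bound xs loopless i v =
    degBound n {{>-nonZero (≤-trans (s≤s z≤n) 2≤n)}} L (suc q) (n≤2^⌈log₂n⌉ n) L≤300[1+q] _ (deg v xs)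
      (greedy-degree xs loopless i v)

  memory-bound : ∀ xs c → memory algorithm xs ≤ 4 * n * L * suc c
  memory-bound xs c = begin
    memory algorithm xs  ≡⟨ greedy-memory xs ⟩
    n * (4 * L)          ≡⟨ x*[4*y]≡4*x*y n L ⟩
    4 * n * L            ≤⟨ m≤m*n (4 * n * L) (suc c) ⟩
    4 * n * L * suc c    ∎
    where
    open ≤-Reasoning
    x*[4*y]≡4*x*y : ∀ x y → x * (4 * y) ≡ 4 * x * y
    x*[4*y]≡4*x*y = solve-∀

lemma3p1 : Σ ℕ λ C → Σ ℕ λ N → (n : ℕ) → N ≤ n →
    Σ (Fin (4 * ⌈log₂ n ⌉) → Fin n → Bool) λ side →
    Σ (OnlineAlg n (4 * ⌈log₂ n ⌉)) λ A →
    (es : List (Edge n)) → SimpleStream es → (k : ℕ) →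
      All (λ p → side (proj₂ p) (proj₁ (proj₁ p)) ≢ side (proj₂ p) (proj₂ (proj₁ p)))
          (assignment A (take k es))
      × ((i : Fin (4 * ⌈log₂ n ⌉)) → (v : Fin n) →
          DegBound n (deg v (assignedTo i (assignment A (take k es)))) (deg v (take k es)))
      × (memory A (take k es) ≤ C * n * ⌈log₂ n ⌉ * (1 + ⌈log₂ maxDeg es ⌉))
lemma3p1 = 4 , 2 , λ n 2≤n → let open Parameters n 2≤n in
  side , algorithm , λ es (loopless , _) k →
      greedy-proper (take k es) (take⁺ k loopless)
    , degree-bound (take k es) (take⁺ k loopless)
    , memory-bound (take k es) ⌈log₂ maxDeg es ⌉
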